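{- Let $m$ and $s$ be even integers with $m\geq 2$, $s\geq 6$ and $s\equiv 0\pmod 6$. Let $t$ be a divisor of $ms$ and set $\ell=\frac{2ms}{t}+1$. There exists a sequence $\mathcal{B}$ of $\frac{m}{2}$ blocks of size $2\times s$ such that $\mathcal{B}$ satisfies Condition (C) and $\operatorname{supp}(\mathcal{B})=[1,ms+\lfloor t/2\rfloor]\setminus\{j\ell: j\in[1,\lfloor t/2\rfloor]\}$.
   Context: For integers $a\leq b$, $[a,b]=\{a,a+1,\ldots,b\}$. A block is a (fully filled) array with integer entries; it is shiftable if every row and every column contains an equal number of positive and negative entries. For a sequence $\mathcal{B}$ of blocks, $\operatorname{supp}(\mathcal{B})$ is the set of absolute values of all entries of all blocks in $\mathcal{B}$. A sequence $\mathcal{B}$ of blocks satisfies Condition (C) if there exist integers $\sigma_1,\ldots,\sigma_b$ (the same for all blocks of the sequence) such that every element $B$ of $\mathcal{B}$ is a shiftable block of size $2\times 2b$ whose two rows each sum to $0$ and whose columns satisfy: the $(2i-1)$-th column sums to $\sigma_i$ and the $2i$-th column sums to $-\sigma_i$, for all $i\in[1,b]$. -}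

module Defs where

open import Data.Nat using (ℕ; zero; suc; _*_; _≤_)
open import Data.Integer as ℤ using (ℤ; 0ℤ; -_; ∣_∣)
open import Data.Integer.Properties using (_<?_)
open import Data.Fin using (Fin; toℕ)
open import Data.Product using (Σ; ∃; _×_)
open import Relation.Nullary.Decidable using (isYes)
open import Relation.Binary.PropositionalEquality using (_≡_)
open import Data.Bool using (if_then_else_)

sumℤ : (n : ℕ) → (Fin n → ℤ) → ℤ
sumℤ zero    f = 0ℤ
sumℤ (suc n) f = f Data.Fin.zero ℤ.+ sumℤ n (λ i → f (Data.Fin.suc i))

countPos : (n : ℕ) → (Fin n → ℤ) → ℕ
countPos zero    f = 0
countPos (suc n) f =
  (if isYes (0ℤ <? f Data.Fin.zero) then 1 else 0) Data.Nat.+ countPos n (λ i → f (Data.Fin.suc i))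

countNeg : (n : ℕ) → (Fin n → ℤ) → ℕ
countNeg zero    f = 0
countNeg (suc n) f =
  (if isYes (f Data.Fin.zero <? 0ℤ) then 1 else 0) Data.Nat.+ countNeg n (λ i → f (Data.Fin.suc i))

Block : ℕ → ℕ → Set
Block r c = Fin r → Fin c → ℤ

row : ∀ {r c} → Block r c → Fin r → Fin c → ℤ
row B i = λ j → B i j

col : ∀ {r c} → Block r c → Fin c → Fin r → ℤ
col B j = λ i → B i j

Shiftable : ∀ {r c} → Block r c → Set
Shiftable {r} {c} B =
  (∀ i → countPos c (row B i) ≡ countNeg c (row B i)) ×
  (∀ j → countPos r (col B j) ≡ countNeg r (col B j))

InSupp : ∀ {k r c} → (Fin k → Block r c) → ℕ → Set
InSupp {k} {r} {c} ℬ x = Σ (Fin k) λ a → Σ (Fin r) λ i → Σ (Fin c) λ j → ∣ ℬ a i j ∣ ≡ x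

-- Condition (C) for a sequence of 2 × n blocks: n = 2b and there are σ₁,…,σ_b (common to all
-- blocks) such that each block is shiftable, both rows sum to 0, column 2i-1 sums to σ_i and
-- column 2i sums to -σ_i (1-based; here 0-based columns 2i and 2i+1 for i : Fin b).
ConditionC : ∀ {k n} → (Fin k → Block 2 n) → Set
ConditionC {k} {n} ℬ =
  Σ ℕ λ b → (n ≡ 2 * b) × Σ (Fin b → ℤ) λ σ → ∀ (a : Fin k) →
    Shiftable (ℬ a) ×
    (∀ (i : Fin 2) → sumℤ n (row (ℬ a) i) ≡ 0ℤ) ×
    (∀ (i : Fin b) (j : Fin n) → toℕ j ≡ 2 * toℕ i → sumℤ 2 (col (ℬ a) j) ≡ σ i) ×
    (∀ (i : Fin b) (j : Fin n) → toℕ j ≡ suc (2 * toℕ i) → sumℤ 2 (col (ℬ a) j) ≡ - σ i)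

-- The entries are the first ms positive integers that are not multiples of ℓ = D + 1,
-- where D = 2ms/t is even: the n-th of them (counting from 0) is 1 + n + ⌊n/D⌋, and the
-- last is ms + ⌊t/2⌋.  Cut them into groups of 12 consecutive ones, each group filling six
-- consecutive columns of one block.  Within a group the k-th value is c + k + J(k), where c
-- is common to the group and the jump profile J counts the skipped multiples of ℓ:
-- J(k) = ⌊k/2⌋ if D = 2, J(k) = ⌊k/4⌋ if D = 4, and otherwise J has a single step, at an
-- even position.  For each such profile a fixed 2 × 6 tile of signs and positions has
-- as many + as − signs in every row and column, so c cancels from every line sum (and the
-- blocks are shiftable), rows sum to 0, and the pairs of columns sum to ±σᵢ, where σ
-- depends only on whether D = 2.

module Submission where

open import Defs
open import Data.Fin using (Fin; zero; suc; toℕ)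
open import Data.Integer using (ℤ)
open import Data.Nat using (ℕ; zero; suc; NonZero; _≤_; _<_)
open import Data.Nat.Divisibility using (_∣_)
open import Data.Product using (Σ; ∃₂; _×_; _,_; proj₁; proj₂)
open import Data.Sign using (Sign)
open import Function using (_∘_)
open import Function.Bundles using (_⇔_; mk⇔; Equivalence)
open import Relation.Binary.PropositionalEquality
open import Relation.Nullary using (¬_; Dec; yes; no; contradiction)

module Sums where
  open import Data.Bool using (if_then_else_)
  open import Data.Fin using (_↑ˡ_; _↑ʳ_; combine)
  open import Data.Integer using (+_; +[1+_]; -[1+_]; 0ℤ; 1ℤ; -1ℤ; _◃_; _+_; _*_; _-_)
  open import Data.Integer.Properties using (_<?_)
  import Data.Integer.Properties as ℤ
  open import Data.Integer.Tactic.RingSolver using (solve-∀)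
  import Data.Nat as ℕ
  open import Relation.Nullary.Decidable using (isYes)

  sumℤ-cong : ∀ n {f g : Fin n → ℤ} → (∀ i → f i ≡ g i) → sumℤ n f ≡ sumℤ n g
  sumℤ-cong ℕ.zero    f≗g = refl
  sumℤ-cong (ℕ.suc n) f≗g = cong₂ _+_ (f≗g zero) (sumℤ-cong n (f≗g ∘ suc))

  sumℤ-zero : ∀ n {f : Fin n → ℤ} → (∀ i → f i ≡ 0ℤ) → sumℤ n f ≡ 0ℤ
  sumℤ-zero ℕ.zero    f≗0 = refl
  sumℤ-zero (ℕ.suc n) f≗0 = cong₂ _+_ (f≗0 zero) (sumℤ-zero n (f≗0 ∘ suc))

  sumℤ-+ : ∀ n (f g : Fin n → ℤ) → sumℤ n (λ i → f i + g i) ≡ sumℤ n f + sumℤ n g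
  sumℤ-+ ℕ.zero    f g = refl
  sumℤ-+ (ℕ.suc n) f g = begin
    f zero + g zero + sumℤ n (λ i → f (suc i) + g (suc i))
      ≡⟨ cong (_+_ (f zero + g zero)) (sumℤ-+ n (f ∘ suc) (g ∘ suc)) ⟩
    f zero + g zero + (sumℤ n (f ∘ suc) + sumℤ n (g ∘ suc))
      ≡⟨ interchange (f zero) (g zero) _ _ ⟩
    f zero + sumℤ n (f ∘ suc) + (g zero + sumℤ n (g ∘ suc)) ∎
    where
    open ≡-Reasoning
    interchange : ∀ a b c d → a + b + (c + d) ≡ a + c + (b + d)
    interchange = solve-∀

  sumℤ-*ʳ : ∀ n (f : Fin n → ℤ) x → sumℤ n (λ i → f i * x) ≡ sumℤ n f * x
  sumℤ-*ʳ ℕ.zero    f x = sym (ℤ.*-zeroˡ x)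
  sumℤ-*ʳ (ℕ.suc n) f x =
    trans (cong (_+_ (f zero * x)) (sumℤ-*ʳ n (f ∘ suc) x)) (sym (ℤ.*-distribʳ-+ x (f zero) _))

  sumℤ-↑ : ∀ m n (f : Fin (m ℕ.+ n) → ℤ) →
           sumℤ (m ℕ.+ n) f ≡ sumℤ m (λ i → f (i ↑ˡ n)) + sumℤ n (λ j → f (m ↑ʳ j))
  sumℤ-↑ ℕ.zero    n f = sym (ℤ.+-identityˡ _)
  sumℤ-↑ (ℕ.suc m) n f =
    trans (cong (_+_ (f zero)) (sumℤ-↑ m n (f ∘ suc))) (sym (ℤ.+-assoc (f zero) _ _))

  sumℤ-combine : ∀ m n (f : Fin (m ℕ.* n) → ℤ) →
                 sumℤ (m ℕ.* n) f ≡ sumℤ m (λ i → sumℤ n (λ j → f (combine i j)))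
  sumℤ-combine ℕ.zero    n f = refl
  sumℤ-combine (ℕ.suc m) n f =
    trans (sumℤ-↑ n (m ℕ.* n) f)
          (cong (_+_ (sumℤ n (λ j → f (j ↑ˡ m ℕ.* n)))) (sumℤ-combine m n (f ∘ (n ↑ʳ_))))

  signum : ℤ → ℤ
  signum (+ ℕ.zero) = 0ℤ
  signum +[1+ _ ]   = 1ℤ
  signum -[1+ _ ]   = -1ℤ

  countPos-countNeg : ∀ n (f : Fin n → ℤ) → + countPos n f - + countNeg n f ≡ sumℤ n (signum ∘ f)
  countPos-countNeg ℕ.zero    f = refl
  countPos-countNeg (ℕ.suc n) f = begin
    + (p ℕ.+ countPos n (f ∘ suc)) - + (q ℕ.+ countNeg n (f ∘ suc))
      ≡⟨ cong₂ _-_ (ℤ.pos-+ p _) (ℤ.pos-+ q _) ⟩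
    (+ p + + countPos n (f ∘ suc)) - (+ q + + countNeg n (f ∘ suc))
      ≡⟨ regroup (+ p) (+ q) (+ countPos n (f ∘ suc)) (+ countNeg n (f ∘ suc)) ⟩
    (+ p - + q) + (+ countPos n (f ∘ suc) - + countNeg n (f ∘ suc))
      ≡⟨ cong₂ _+_ (indicators-signum (f zero)) (countPos-countNeg n (f ∘ suc)) ⟩
    signum (f zero) + sumℤ n (signum ∘ f ∘ suc) ∎
    where
    open ≡-Reasoning
    p = if isYes (0ℤ <? f zero) then 1 else 0
    q = if isYes (f zero <? 0ℤ) then 1 else 0
    regroup : ∀ a b c d → (a + c) - (b + d) ≡ (a - b) + (c - d)
    regroup = solve-∀
    indicators-signum : ∀ x → + (if isYes (0ℤ <? x) then 1 else 0) - + (if isYes (x <? 0ℤ) then 1 else 0) ≡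
                              signum x
    indicators-signum (+ ℕ.zero) = refl
    indicators-signum +[1+ _ ]   = refl
    indicators-signum -[1+ _ ]   = refl

  countPos≡countNeg : ∀ n (f : Fin n → ℤ) → sumℤ n (signum ∘ f) ≡ 0ℤ → countPos n f ≡ countNeg n f
  countPos≡countNeg n f balanced =
    ℤ.+-injective (ℤ.i-j≡0⇒i≡j _ _ (trans (countPos-countNeg n f) balanced))

  balance : ∀ {n} → (Fin n → Sign) → ℤ
  balance {n} ε = sumℤ n (λ v → ε v ◃ 1)

  signum-◃ : ∀ s x → signum (s ◃ ℕ.suc x) ≡ s ◃ 1
  signum-◃ Sign.+ x = refl
  signum-◃ Sign.- x = refl

  ◃-via-* : ∀ s c → s ◃ c ≡ (s ◃ 1) * + c
  ◃-via-* Sign.+ c = trans (ℤ.+◃n≡+n c) (sym (ℤ.*-identityˡ (+ c)))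
  ◃-via-* Sign.- c = trans (ℤ.-◃n≡-n c) (sym (ℤ.-1*i≡-i (+ c)))

  sumℤ-◃-shift : ∀ n (ε : Fin n → Sign) c (o : Fin n → ℕ) →
                 sumℤ n (λ v → ε v ◃ (c ℕ.+ o v)) ≡ balance ε * + c + sumℤ n (λ v → ε v ◃ o v)
  sumℤ-◃-shift n ε c o = begin
    sumℤ n (λ v → ε v ◃ (c ℕ.+ o v))
      ≡⟨ sumℤ-cong n (λ v → trans (ℤ.◃-distrib-+ (ε v) c (o v))
                                   (cong (_+ (ε v ◃ o v)) (◃-via-* (ε v) c))) ⟩
    sumℤ n (λ v → (ε v ◃ 1) * + c + (ε v ◃ o v))
      ≡⟨ sumℤ-+ n _ _ ⟩
    sumℤ n (λ v → (ε v ◃ 1) * + c) + sumℤ n (λ v → ε v ◃ o v)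
      ≡⟨ cong (_+ sumℤ n (λ v → ε v ◃ o v)) (sumℤ-*ʳ n (λ v → ε v ◃ 1) (+ c)) ⟩
    balance ε * + c + sumℤ n (λ v → ε v ◃ o v) ∎
    where open ≡-Reasoning

  sumℤ-signum-◃ : ∀ n (ε : Fin n → Sign) (x : Fin n → ℕ) →
                  sumℤ n (λ v → signum (ε v ◃ ℕ.suc (x v))) ≡ balance ε
  sumℤ-signum-◃ n ε x = sumℤ-cong n (λ v → signum-◃ (ε v) (x v))

open Sums

module NonMultiples where
  open import Data.Empty using (⊥; ⊥-elim)
  open import Data.Fin.Properties using (toℕ<n)
  open import Data.Nat using (_+_; _*_; _/_; _%_; z≤n; s≤s; _≟_; _≤?_; _<?_)
  open import Data.Nat.DivMod
  open import Data.Nat.Divisibility using (divides; divides-refl; n∣m⇒m%n≡0)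
  open import Data.Nat.Properties
  open import Data.Nat.Tactic.RingSolver using (solve-∀)

  -- The (n + 1)-st positive integer that is not a multiple of D + 1.
  nonMultiple : (D : ℕ) .{{_ : NonZero D}} → ℕ → ℕ
  nonMultiple D n = suc (n + n / D)

  IntervalMinusMultiples : (M h D x : ℕ) → Set
  IntervalMinusMultiples M h D x =
    (1 ≤ x × x ≤ M + h) × ¬ (Σ ℕ λ j → (1 ≤ j × j ≤ h) × x ≡ j * (D + 1))

  module _ (D : ℕ) .{{_ : NonZero D}} where

    /-+-split : ∀ n k → (n + k) / D ≡ n / D + (n % D + k) / D
    /-+-split n k = begin
      (n + k) / D                   ≡⟨ cong (λ z → (z + k) / D) (m≡m%n+[m/n]*n n D) ⟩
      (n % D + n / D * D + k) / D   ≡⟨ cong (_/ D) (swap-last (n % D) (n / D * D) k) ⟩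
      (n % D + k + n / D * D) / D   ≡⟨ +-distrib-/-∣ʳ (n % D + k) (divides-refl (n / D)) ⟩
      (n % D + k) / D + n / D * D / D ≡⟨ cong ((n % D + k) / D +_) (m*n/n≡m (n / D) D) ⟩
      (n % D + k) / D + n / D       ≡⟨ +-comm _ (n / D) ⟩
      n / D + (n % D + k) / D       ∎
      where
      open ≡-Reasoning
      swap-last : ∀ a b c → a + b + c ≡ a + c + b
      swap-last = solve-∀

    nonMultiple-+ : ∀ n k → nonMultiple D (n + k) ≡ nonMultiple D n + (k + (n % D + k) / D)
    nonMultiple-+ n k = trans (cong (λ z → suc (n + k + z)) (/-+-split n k)) (cong suc (regroup n k (n / D) _))
      where
      regroup : ∀ n k q j → n + k + (q + j) ≡ n + q + (k + j)
      regroup = solve-∀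

    nonMultiple-% : ∀ n → nonMultiple D n % suc D ≡ suc (n % D)
    nonMultiple-% n = begin
      suc (n + n / D) % suc D                       ≡⟨ cong (λ z → suc (z + n / D) % suc D) (m≡m%n+[m/n]*n n D) ⟩
      suc (n % D + n / D * D + n / D) % suc D       ≡⟨ cong (_% suc D) (regroup (n % D) (n / D) D) ⟩
      (suc (n % D) + n / D * suc D) % suc D         ≡⟨ [m+kn]%n≡m%n (suc (n % D)) (n / D) (suc D) ⟩
      suc (n % D) % suc D                           ≡⟨ m<n⇒m%n≡m (s≤s (m%n<n n D)) ⟩
      suc (n % D)                                   ∎
      where
      open ≡-Reasoning
      regroup : ∀ r q D → suc (r + q * D + q) ≡ suc r + q * suc D
      regroup = solve-∀

    nonMultiple-∤ : ∀ n → ¬ (suc D ∣ nonMultiple D n)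
    nonMultiple-∤ n ℓ∣x = 0≢1+n (trans (sym (n∣m⇒m%n≡0 _ (suc D) ℓ∣x)) (nonMultiple-% n))

    nonMultiple-∈ : ∀ M n → n < M → IntervalMinusMultiples M (M / D) D (nonMultiple D n)
    nonMultiple-∈ M n n<M =
      (s≤s z≤n , +-mono-≤ n<M (/-monoˡ-≤ D (<⇒≤ n<M))) ,
      λ (j , _ , x≡) → nonMultiple-∤ n (divides j (trans x≡ (cong (j *_) (+-comm D 1))))

    <-[1+m/n]*n : ∀ M q → M / D ≤ q → M < suc q * D
    <-[1+m/n]*n M q M/D≤q = begin-strict
      M                 ≡⟨ m≡m%n+[m/n]*n M D ⟩
      M % D + M / D * D <⟨ +-monoˡ-< (M / D * D) (m%n<n M D) ⟩
      suc (M / D) * D   ≤⟨ *-monoˡ-≤ D (s≤s M/D≤q) ⟩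
      suc q * D         ∎
      where open ≤-Reasoning

    multiple-beyond : ∀ M q → M / D ≤ q → M + M / D < suc q * suc D
    multiple-beyond M q M/D≤q = begin-strict
      M + M / D         <⟨ +-mono-< (<-[1+m/n]*n M q M/D≤q) (s≤s M/D≤q) ⟩
      suc q * D + suc q ≡⟨ +-comm (suc q * D) (suc q) ⟩
      suc q + suc q * D ≡⟨ *-suc (suc q) D ⟨
      suc q * suc D     ∎
      where open ≤-Reasoning

    -- Write x − 1 = q (D + 1) + e: if e = D then x = (q + 1)(D + 1) is an excluded multiple
    -- (or exceeds the bound), otherwise x = nonMultiple D (e + q D).
    nonMultiple-onto : ∀ M x → IntervalMinusMultiples M (M / D) D x →
                       Σ ℕ λ n → n < M × nonMultiple D n ≡ x
    nonMultiple-onto M zero ((() , _) , _)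
    nonMultiple-onto M (suc y) ((_ , x≤) , ¬multiple) with y divMod suc D
    ... | result q e y≡ with toℕ e ≟ D
    ...   | yes e≡D = ⊥-elim (multiple-in-range (suc q ≤? M / D))
      where
      x≡ : suc y ≡ suc q * suc D
      x≡ = cong suc (trans y≡ (cong (_+ q * suc D) e≡D))
      multiple-in-range : Dec (suc q ≤ M / D) → ⊥
      multiple-in-range (yes q<) = ¬multiple (suc q , (s≤s z≤n , q<) , trans x≡ (cong (suc q *_) (+-comm 1 D)))
      multiple-in-range (no q≮) = <⇒≱ (multiple-beyond M q (≤-pred (≰⇒> q≮))) (subst (_≤ M + M / D) x≡ x≤)
    ...   | no e≢D = n , n<M , x≡
      where
      n = toℕ e + q * D
      n/D≡q : n / D ≡ q
      n/D≡q = begin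
        (toℕ e + q * D) / D         ≡⟨ +-distrib-/-∣ʳ (toℕ e) (divides-refl q) ⟩
        toℕ e / D + q * D / D       ≡⟨ cong₂ _+_ (m<n⇒m/n≡0 e<D) (m*n/n≡m q D) ⟩
        q                           ∎
        where
        open ≡-Reasoning
        e<D = ≤∧≢⇒< (≤-pred (toℕ<n e)) e≢D
      x≡ : nonMultiple D n ≡ suc y
      x≡ = cong suc (trans (cong (n +_) n/D≡q) (trans (regroup (toℕ e) q D) (sym y≡)))
        where
        regroup : ∀ e q D → e + q * D + q ≡ e + q * suc D
        regroup = solve-∀
      n<M : n < M
      n<M with n <? M
      ... | yes n<M = n<M
      ... | no n≮M = ⊥-elim (<⇒≱ (subst (M + M / D <_) x≡ (s≤s (+-mono-≤ M≤n (/-monoˡ-≤ D M≤n)))) x≤)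
        where M≤n = ≮⇒≥ n≮M

    nonMultiple-image : ∀ M x → (Σ ℕ λ n → n < M × nonMultiple D n ≡ x) ⇔ IntervalMinusMultiples M (M / D) D x
    nonMultiple-image M x = mk⇔ (λ { (n , n<M , refl) → nonMultiple-∈ M n n<M }) (nonMultiple-onto M x)

open NonMultiples

module Tiles where
  open import Data.Bool using (if_then_else_)
  open import Data.Fin using (combine)
  open import Data.Fin.Properties using (all?; any?; toℕ<n) renaming (_≟_ to _≟ᶠ_)
  open import Data.Integer using (+_; 0ℤ; -_; _◃_; _+_; _*_)
  open import Data.Integer.Properties using (+-identityˡ) renaming (_≟_ to _≟ℤ_)
  import Data.Nat as ℕ
  import Data.Nat.Properties as ℕ
  open import Data.Vec using (Vec; []; _∷_; lookup)
  open import Relation.Nullary.Decidable using (_×-dec_; from-yes; isYes; map′)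

  -- The cell ⊕ k (resp. ⊖ k) of a tile holds the k-th value of its group with sign + (resp. −).
  data Cell : Set where
    ⊕_ ⊖_ : Fin 12 → Cell

  cellSign : Cell → Sign
  cellSign (⊕ _) = Sign.+
  cellSign (⊖ _) = Sign.-

  cellIndex : Cell → Fin 12
  cellIndex (⊕ k) = k
  cellIndex (⊖ k) = k

  data Tile : Set where
    quads halves jump₂ jump₆ jump₁₀ : Tile

  module Layouts where
    open import Agda.Builtin.FromNat using (Number; fromNat)
    import Data.Fin.Literals as Fin
    import Data.Nat.Literals as ℕ
    open import Data.Unit using (tt)

    private instance
      finLiterals : ∀ {n} → Number (Fin n)
      finLiterals {n} = Fin.number n
      natLiterals : Number ℕ
      natLiterals = ℕ.number

    table : Tile → Vec (Vec Cell 6) 2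
    table quads  = (⊕ 3  ∷ ⊖ 2 ∷ ⊖ 6 ∷ ⊕ 4  ∷ ⊕ 11 ∷ ⊖ 10 ∷ []) ∷
                   (⊖ 1  ∷ ⊕ 0 ∷ ⊕ 7 ∷ ⊖ 5  ∷ ⊖ 9  ∷ ⊕ 8  ∷ []) ∷ []
    table halves = (⊖ 11 ∷ ⊕ 9 ∷ ⊖ 7 ∷ ⊕ 5  ∷ ⊖ 6  ∷ ⊕ 10 ∷ []) ∷
                   (⊕ 2  ∷ ⊖ 0 ∷ ⊕ 3 ∷ ⊖ 1  ∷ ⊕ 4  ∷ ⊖ 8  ∷ []) ∷ []
    table jump₂  = (⊖ 9  ∷ ⊕ 2 ∷ ⊖ 6 ∷ ⊖ 1  ∷ ⊕ 10 ∷ ⊕ 3  ∷ []) ∷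
                   (⊕ 11 ∷ ⊖ 4 ∷ ⊕ 7 ∷ ⊕ 0  ∷ ⊖ 8  ∷ ⊖ 5  ∷ []) ∷ []
    table jump₆  = (⊕ 4  ∷ ⊕ 3 ∷ ⊖ 0 ∷ ⊖ 7  ∷ ⊖ 8  ∷ ⊕ 9  ∷ []) ∷
                   (⊖ 2  ∷ ⊖ 5 ∷ ⊕ 1 ∷ ⊕ 6  ∷ ⊕ 10 ∷ ⊖ 11 ∷ []) ∷ []
    table jump₁₀ = (⊕ 9  ∷ ⊖ 2 ∷ ⊖ 4 ∷ ⊖ 11 ∷ ⊕ 3  ∷ ⊕ 6  ∷ []) ∷
                   (⊖ 7  ∷ ⊕ 0 ∷ ⊕ 5 ∷ ⊕ 10 ∷ ⊖ 1  ∷ ⊖ 8  ∷ []) ∷ []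

  cell : Tile → Fin 2 → Fin 6 → Cell
  cell T i v = lookup {n = 6} (lookup {n = 2} (Layouts.table T) i) v

  record WellFormed (T : Tile) : Set where
    field
      rows-balanced    : ∀ i → balance (λ v → cellSign (cell T i v)) ≡ 0ℤ
      columns-balanced : ∀ v → balance (λ i → cellSign (cell T i v)) ≡ 0ℤ
      covers           : ∀ k → ∃₂ λ i v → cellIndex (cell T i v) ≡ k

  wellFormed? : ∀ T → Dec (WellFormed T)
  wellFormed? T =
    map′ (λ (r , c , k) → record { rows-balanced = r ; columns-balanced = c ; covers = k })
         (λ wf → let open WellFormed wf in rows-balanced , columns-balanced , covers)
      (all? (λ i → balance (λ v → cellSign (cell T i v)) ≟ℤ 0ℤ) ×-dec
       all? (λ v → balance (λ i → cellSign (cell T i v)) ≟ℤ 0ℤ) ×-dec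
       all? (λ k → any? λ i → any? λ v → cellIndex (cell T i v) ≟ᶠ k))

  wellFormed : ∀ T → WellFormed T
  wellFormed quads  = from-yes (wellFormed? quads)
  wellFormed halves = from-yes (wellFormed? halves)
  wellFormed jump₂  = from-yes (wellFormed? jump₂)
  wellFormed jump₆  = from-yes (wellFormed? jump₆)
  wellFormed jump₁₀ = from-yes (wellFormed? jump₁₀)

  Profile : Set
  Profile = Fin 12 → ℕ

  offset : Profile → Fin 12 → ℕ
  offset J k = toℕ k ℕ.+ J k

  cellOffset : Profile → Cell → ℤ
  cellOffset J c = cellSign c ◃ offset J (cellIndex c)

  pairColumn : Fin 3 → Fin 2 → Fin 6
  pairColumn = combine

  record Fits (T : Tile) (J : Profile) (σ : Fin 3 → ℤ) : Set where
    field
      rows-fit  : ∀ i → sumℤ 6 (λ v → cellOffset J (cell T i v)) ≡ 0ℤ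
      evens-fit : ∀ r → sumℤ 2 (λ i → cellOffset J (cell T i (pairColumn r zero))) ≡ σ r
      odds-fit  : ∀ r → sumℤ 2 (λ i → cellOffset J (cell T i (pairColumn r (suc zero)))) ≡ - σ r

  fits? : ∀ T J σ → Dec (Fits T J σ)
  fits? T J σ =
    map′ (λ (r , e , o) → record { rows-fit = r ; evens-fit = e ; odds-fit = o })
         (λ f → let open Fits f in rows-fit , evens-fit , odds-fit)
      (all? (λ i → _ ≟ℤ 0ℤ) ×-dec all? (λ r → _ ≟ℤ σ r) ×-dec all? (λ r → _ ≟ℤ - σ r))

  σ-quads σ-halves : Fin 3 → ℤ
  σ-quads  = lookup (+ 2 ∷ + 1 ∷ + 2 ∷ [])
  σ-halves = lookup (- + 13 ∷ - + 6 ∷ - + 3 ∷ [])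

  jumpAt : ℕ → Profile
  jumpAt p k = if isYes (p ℕ.≤? toℕ k) then 1 else 0

  quads-fits-quarters : Fits quads (λ k → toℕ k ℕ./ 4) σ-quads
  quads-fits-quarters = from-yes (fits? quads (λ k → toℕ k ℕ./ 4) σ-quads)

  halves-fits-halves : Fits halves (λ k → toℕ k ℕ./ 2) σ-halves
  halves-fits-halves = from-yes (fits? halves (λ k → toℕ k ℕ./ 2) σ-halves)

  fits-cong : ∀ {T J J′ σ} → (∀ k → J k ≡ J′ k) → Fits T J σ → Fits T J′ σ
  fits-cong {T} {J} {J′} J≗J′ fits = record
    { rows-fit  = λ i → trans (sym (sumℤ-cong 6 (λ v → same (cell T i v)))) (rows-fit i)
    ; evens-fit = λ r → trans (sym (sumℤ-cong 2 (λ i → same (cell T i (pairColumn r zero))))) (evens-fit r)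
    ; odds-fit  = λ r → trans (sym (sumℤ-cong 2 (λ i → same (cell T i (pairColumn r (suc zero)))))) (odds-fit r)
    }
    where
    open Fits fits
    same : ∀ c → cellOffset J c ≡ cellOffset J′ c
    same c = cong (λ z → cellSign c ◃ (toℕ (cellIndex c) ℕ.+ z)) (J≗J′ (cellIndex c))

  jumpAt-beyond : ∀ p k → 12 ℕ.≤ p → jumpAt p k ≡ 0
  jumpAt-beyond p k 12≤p with p ℕ.≤? toℕ k
  ... | yes p≤k = contradiction (ℕ.≤-trans 12≤p p≤k) (ℕ.<⇒≱ (toℕ<n k))
  ... | no _    = refl

  -- Indexed by half the jump position; quads also fits a jump at 4, at 8 or beyond the group.
  jumpTile : ℕ → Tile
  jumpTile 1 = jump₂
  jumpTile 3 = jump₆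
  jumpTile 5 = jump₁₀
  jumpTile _ = quads

  jumpTile-fits : ∀ q → Fits (jumpTile (suc q)) (jumpAt (suc q ℕ.* 2)) σ-quads
  jumpTile-fits 0 = from-yes (fits? jump₂ (jumpAt 2) σ-quads)
  jumpTile-fits 1 = from-yes (fits? quads (jumpAt 4) σ-quads)
  jumpTile-fits 2 = from-yes (fits? jump₆ (jumpAt 6) σ-quads)
  jumpTile-fits 3 = from-yes (fits? quads (jumpAt 8) σ-quads)
  jumpTile-fits 4 = from-yes (fits? jump₁₀ (jumpAt 10) σ-quads)
  jumpTile-fits q@(suc (suc (suc (suc (suc x))))) =
    fits-cong {T = quads} {J = λ _ → 0} (λ k → sym (jumpAt-beyond (suc q ℕ.* 2) k 12≤2q)) quads-fits-flat
    where
    12≤2q = ℕ.m≤m+n 12 (x ℕ.* 2)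
    quads-fits-flat : Fits quads (λ _ → 0) σ-quads
    quads-fits-flat = from-yes (fits? quads (λ _ → 0) σ-quads)

  entry : Tile → Profile → ℕ → Fin 2 → Fin 6 → ℤ
  entry T J b i v = cellSign (cell T i v) ◃ (b ℕ.+ offset J (cellIndex (cell T i v)))

  balanced-line-sum : ∀ n (c : Fin n → Cell) J b → balance (cellSign ∘ c) ≡ 0ℤ →
                      sumℤ n (λ v → cellSign (c v) ◃ (b ℕ.+ offset J (cellIndex (c v)))) ≡
                      sumℤ n (cellOffset J ∘ c)
  balanced-line-sum n c J b balanced =
    trans (sumℤ-◃-shift n (cellSign ∘ c) b (offset J ∘ cellIndex ∘ c))
          (trans (cong (λ β → β * + b + sumℤ n (cellOffset J ∘ c)) balanced) (+-identityˡ _))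

  module _ {T J σ} (fits : Fits T J σ) (b : ℕ) where

    entry-row-sum : ∀ i → sumℤ 6 (entry T J b i) ≡ 0ℤ
    entry-row-sum i =
      trans (balanced-line-sum 6 (cell T i) J b (WellFormed.rows-balanced (wellFormed T) i)) (Fits.rows-fit fits i)

    entry-column-sum : ∀ v → sumℤ 2 (λ i → entry T J b i v) ≡ sumℤ 2 (λ i → cellOffset J (cell T i v))
    entry-column-sum v = balanced-line-sum 2 (λ i → cell T i v) J b (WellFormed.columns-balanced (wellFormed T) v)

    entry-pair-sums : ∀ r → sumℤ 2 (λ i → entry T J b i (pairColumn r zero)) ≡ σ r ×
                            sumℤ 2 (λ i → entry T J b i (pairColumn r (suc zero))) ≡ - σ r
    entry-pair-sums r =
      trans (entry-column-sum (pairColumn r zero)) (Fits.evens-fit fits r) ,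
      trans (entry-column-sum (pairColumn r (suc zero))) (Fits.odds-fit fits r)

  entry-row-signum : ∀ T J b i → sumℤ 6 (λ v → signum (entry T J (suc b) i v)) ≡ 0ℤ
  entry-row-signum T J b i =
    trans (sumℤ-signum-◃ 6 (λ v → cellSign (cell T i v)) (λ v → b ℕ.+ offset J (cellIndex (cell T i v))))
          (WellFormed.rows-balanced (wellFormed T) i)

  entry-column-signum : ∀ T J b v → sumℤ 2 (λ i → signum (entry T J (suc b) i v)) ≡ 0ℤ
  entry-column-signum T J b v =
    trans (sumℤ-signum-◃ 2 (λ i → cellSign (cell T i v)) (λ i → b ℕ.+ offset J (cellIndex (cell T i v))))
          (WellFormed.columns-balanced (wellFormed T) v)

open Tiles

module JumpProfiles where
  open import Data.Fin.Properties using (toℕ<n)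
  open import Data.Nat using (_+_; _*_; _∸_; _/_; _%_; _≤?_)
  open import Data.Nat.DivMod
  open import Data.Nat.Divisibility using (divides; ∣m⇒∣m*n; ∣m+n∣m⇒∣n; %-presˡ-∣; n∣m⇒m%n≡0)
  open import Data.Nat.Properties
  open import Data.Nat.Tactic.RingSolver using (solve-∀)

  multiples-gap : ∀ {g a b} → g ∣ a → g ∣ b → a < b → a + g ≤ b
  multiples-gap {g} (divides α refl) (divides β refl) αg<βg =
    subst (_≤ β * g) (+-comm g (α * g)) (*-monoˡ-≤ g (*-cancelʳ-< g α β αg<βg))

  jumps : (D : ℕ) .{{_ : NonZero D}} → ℕ → Profile
  jumps D c k = (c + toℕ k) / D

  module _ (D : ℕ) .{{_ : NonZero D}} where

    jumps-at-most-once : ∀ c k → c < D → c + toℕ k < D + D → jumps D c k ≡ jumpAt (D ∸ c) k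
    jumps-at-most-once c k c<D c+k<2D with D ∸ c ≤? toℕ k
    ... | yes D∸c≤k = begin
      (c + toℕ k) / D           ≡⟨ m/n≡1+[m∸n]/n D≤c+k ⟩
      suc ((c + toℕ k ∸ D) / D) ≡⟨ cong suc (m<n⇒m/n≡0 c+k∸D<D) ⟩
      1                         ∎
      where
      open ≡-Reasoning
      D≤c+k : D ≤ c + toℕ k
      D≤c+k = subst₂ _≤_ (m∸n+n≡m (<⇒≤ c<D)) (+-comm (toℕ k) c) (+-monoˡ-≤ c D∸c≤k)
      c+k∸D<D = subst (c + toℕ k ∸ D <_) (m+n∸n≡m D D) (∸-monoˡ-< c+k<2D D≤c+k)
    ... | no D∸c≰k =
      m<n⇒m/n≡0 (subst₂ _<_ (+-comm (toℕ k) c) (m∸n+n≡m (<⇒≤ c<D)) (+-monoˡ-< c (≰⇒> D∸c≰k)))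

    window-bound : ∀ g n → g ∣ 12 → g ∣ D → 12 ≤ D + g → (12 * n) % D + 12 ≤ D + D
    window-bound g n g∣12 g∣D 12≤D+g = begin
      c + 12       ≤⟨ +-monoʳ-≤ c 12≤D+g ⟩
      c + (D + g)  ≡⟨ regroup c D g ⟩
      c + g + D    ≤⟨ +-monoˡ-≤ D (multiples-gap g∣c g∣D (m%n<n (12 * n) D)) ⟩
      D + D        ∎
      where
      open ≤-Reasoning
      c = (12 * n) % D
      g∣c = %-presˡ-∣ (∣m⇒∣m*n n g∣12) g∣D
      regroup : ∀ c D g → c + (D + g) ≡ c + g + D
      regroup = solve-∀

    jumpTile-fits-window : ∀ c → c < D → c + 12 ≤ D + D → 2 ∣ D ∸ c →
                           Fits (jumpTile ((D ∸ c) / 2)) (jumps D c) σ-quads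
    jumpTile-fits-window c c<D bound (divides zero D∸c≡0) = contradiction D∸c≡0 (>⇒≢ (m<n⇒0<n∸m c<D))
    jumpTile-fits-window c c<D bound (divides (suc q) D∸c≡) =
      subst (λ T → Fits T (jumps D c) σ-quads) (cong jumpTile (sym half))
        (fits-cong {T = jumpTile (suc q)} (λ k → sym (jumps-at-most-once c k c<D (c+k<2D k)))
          (subst (λ p → Fits (jumpTile (suc q)) (jumpAt p) σ-quads) (sym D∸c≡) (jumpTile-fits q)))
      where
      c+k<2D : ∀ k → c + toℕ k < D + D
      c+k<2D k = <-≤-trans (+-monoʳ-< c (toℕ<n k)) bound
      half : (D ∸ c) / 2 ≡ suc q
      half = trans (cong (_/ 2) D∸c≡) (m*n/n≡m (suc q) 2)

  tileFor : ℕ → ℕ → Tile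
  tileFor 2 _ = halves
  tileFor 4 _ = quads
  tileFor D c = jumpTile ((D ∸ c) / 2)

  σ-for : ℕ → Fin 3 → ℤ
  σ-for 2 = σ-halves
  σ-for _ = σ-quads

  window-bound-≥6 : ∀ R n → (12 * n) % (suc (suc (suc R)) * 2) + 12 ≤ suc (suc (suc R)) * 2 + suc (suc (suc R)) * 2
  window-bound-≥6 zero          n = window-bound 6 6 n (divides 2 refl) (divides 1 refl) ≤-refl
  window-bound-≥6 (suc zero)    n = window-bound 8 4 n (divides 3 refl) (divides 2 refl) ≤-refl
  window-bound-≥6 (suc (suc R)) n =
    window-bound (suc (suc (suc (suc (suc R)))) * 2) 2 n (divides 6 refl) (divides (suc (suc (suc (suc (suc R))))) refl)
                 (+-monoˡ-≤ 2 (m≤m+n 10 (R * 2)))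

  tileFor-fits : ∀ R n → let D = suc R * 2; c = (12 * n) % D in Fits (tileFor D c) (jumps D c) (σ-for D)
  tileFor-fits zero n =
    subst (λ c → Fits halves (jumps 2 c) σ-halves)
          (sym (n∣m⇒m%n≡0 (12 * n) 2 (∣m⇒∣m*n n (divides 6 refl)))) halves-fits-halves
  tileFor-fits (suc zero) n =
    subst (λ c → Fits quads (jumps 4 c) σ-quads)
          (sym (n∣m⇒m%n≡0 (12 * n) 4 (∣m⇒∣m*n n (divides 3 refl)))) quads-fits-quarters
  tileFor-fits (suc (suc R)) n =
    jumpTile-fits-window D c c<D (window-bound-≥6 R n)
      (∣m+n∣m⇒∣n (subst (2 ∣_) (sym (m+[n∸m]≡n (<⇒≤ c<D))) 2∣D) 2∣c)
    where
    D = suc (suc (suc R)) * 2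
    c = (12 * n) % D
    c<D = m%n<n (12 * n) D
    2∣D : 2 ∣ D
    2∣D = divides (suc (suc (suc R))) refl
    2∣c = %-presˡ-∣ (∣m⇒∣m*n n (divides 6 refl)) 2∣D

open JumpProfiles

module ColumnPairs where
  open import Data.Fin using (combine; remQuot)
  open import Data.Fin.Properties using (remQuot-combine; combine-remQuot; toℕ-combine; toℕ-injective)
  open import Data.Nat using (_+_; _*_)
  open import Data.Nat.Tactic.RingSolver using (solve-∀)

  remQuot-pair : ∀ {m k} (i : Fin (m * k)) (e : Fin 2) (j : Fin (m * (k * 2))) →
                 toℕ j ≡ 2 * toℕ i + toℕ e →
                 remQuot (k * 2) j ≡ (proj₁ (remQuot {m} k i) , combine (proj₂ (remQuot {m} k i)) e)
  remQuot-pair {m} {k} i e j j≡ =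
    trans (cong (remQuot {m} (k * 2)) (toℕ-injective toℕ-j)) (remQuot-combine u (combine r e))
    where
    u = proj₁ (remQuot {m} k i)
    r = proj₂ (remQuot {m} k i)
    regroup : ∀ k u r e → 2 * (k * u + r) + e ≡ k * 2 * u + (2 * r + e)
    regroup = solve-∀
    toℕ-j : toℕ j ≡ toℕ (combine u (combine r e))
    toℕ-j = begin
      toℕ j                                  ≡⟨ j≡ ⟩
      2 * toℕ i + toℕ e                      ≡⟨ cong (λ z → 2 * toℕ z + toℕ e) (combine-remQuot {m} k i) ⟨
      2 * toℕ (combine u r) + toℕ e          ≡⟨ cong (λ z → 2 * z + toℕ e) (toℕ-combine u r) ⟩
      2 * (k * toℕ u + toℕ r) + toℕ e        ≡⟨ regroup k (toℕ u) (toℕ r) (toℕ e) ⟩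
      k * 2 * toℕ u + (2 * toℕ r + toℕ e)    ≡⟨ cong (k * 2 * toℕ u +_) (toℕ-combine r e) ⟨
      k * 2 * toℕ u + toℕ (combine r e)      ≡⟨ toℕ-combine u (combine r e) ⟨
      toℕ (combine u (combine r e))          ∎
      where open ≡-Reasoning

open ColumnPairs

module Construction (K U R : ℕ) where
  open import Data.Fin using (combine; remQuot; fromℕ<)
  open import Data.Fin.Properties using (remQuot-combine; combine-remQuot; toℕ-combine; toℕ<n; toℕ-fromℕ<)
  open import Data.Integer using (∣_∣; _◃_; 0ℤ; -_)
  open import Data.Integer.Properties using (abs-◃)
  open import Data.Nat using (_+_; _*_; _/_; _%_)
  open import Data.Nat.Properties using (+-identityʳ; +-comm)
  open import Data.Nat.Tactic.RingSolver using (solve-∀)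

  -- D = 2ms/t with ms/t = suc R, written so that tileFor D and σ-for D compute by matching on R.
  D : ℕ
  D = suc R * 2

  window : Fin (K * U) → ℕ
  window w = (12 * toℕ w) % D

  tileOf : Fin (K * U) → Tile
  tileOf w = tileFor D (window w)

  profile : Fin (K * U) → Profile
  profile w = jumps D (window w)

  value : Fin (K * U * 12) → ℕ
  value n = nonMultiple D (toℕ n)

  groupEntry : Fin (K * U) → Fin 2 → Fin 6 → ℤ
  groupEntry w i v = cellSign c ◃ value (combine w (cellIndex c))
    where c = cell (tileOf w) i v

  blocks : Fin K → Block 2 (U * 6)
  blocks a i j = groupEntry (combine a (proj₁ (remQuot {U} 6 j))) i (proj₂ (remQuot {U} 6 j))

  groupEntry≡entry : ∀ w i v → groupEntry w i v ≡ entry (tileOf w) (profile w) (nonMultiple D (12 * toℕ w)) i v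
  groupEntry≡entry w i v =
    cong (cellSign c ◃_) (trans (cong (nonMultiple D) (toℕ-combine w k)) (nonMultiple-+ D (12 * toℕ w) (toℕ k)))
    where
    c = cell (tileOf w) i v
    k = cellIndex c

  module _ (w : Fin (K * U)) where

    private
      n = 12 * toℕ w
      fits : Fits (tileOf w) (profile w) (σ-for D)
      fits = tileFor-fits R (toℕ w)

    group-row-sum : ∀ i → sumℤ 6 (groupEntry w i) ≡ 0ℤ
    group-row-sum i = trans (sumℤ-cong 6 (groupEntry≡entry w i)) (entry-row-sum fits (nonMultiple D n) i)

    group-row-signum : ∀ i → sumℤ 6 (signum ∘ groupEntry w i) ≡ 0ℤ
    group-row-signum i = trans (sumℤ-cong 6 (cong signum ∘ groupEntry≡entry w i))
                               (entry-row-signum (tileOf w) (profile w) (n + n / D) i)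

    group-column-signum : ∀ v → sumℤ 2 (λ i → signum (groupEntry w i v)) ≡ 0ℤ
    group-column-signum v = trans (sumℤ-cong 2 (λ i → cong signum (groupEntry≡entry w i v)))
                                  (entry-column-signum (tileOf w) (profile w) (n + n / D) v)

    group-pair-sums : ∀ r → sumℤ 2 (λ i → groupEntry w i (pairColumn r zero)) ≡ σ-for D r ×
                            sumℤ 2 (λ i → groupEntry w i (pairColumn r (suc zero))) ≡ - σ-for D r
    group-pair-sums r =
      trans (sumℤ-cong 2 (λ i → groupEntry≡entry w i (pairColumn r zero)))
            (proj₁ (entry-pair-sums fits (nonMultiple D n) r)) ,
      trans (sumℤ-cong 2 (λ i → groupEntry≡entry w i (pairColumn r (suc zero))))
            (proj₂ (entry-pair-sums fits (nonMultiple D n) r))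

  blocks-combine : ∀ a i u v → blocks a i (combine u v) ≡ groupEntry (combine a u) i v
  blocks-combine a i u v = cong (λ (u′ , v′) → groupEntry (combine a u′) i v′) (remQuot-combine {U} {6} u v)

  row-sum : ∀ a i → sumℤ (U * 6) (row (blocks a) i) ≡ 0ℤ
  row-sum a i = trans (sumℤ-combine U 6 (blocks a i)) (sumℤ-zero U λ u →
    trans (sumℤ-cong 6 (blocks-combine a i u)) (group-row-sum (combine a u) i))

  row-balanced : ∀ a i → countPos (U * 6) (row (blocks a) i) ≡ countNeg (U * 6) (row (blocks a) i)
  row-balanced a i = countPos≡countNeg (U * 6) (blocks a i)
    (trans (sumℤ-combine U 6 (signum ∘ blocks a i)) (sumℤ-zero U λ u →
      trans (sumℤ-cong 6 (cong signum ∘ blocks-combine a i u)) (group-row-signum (combine a u) i)))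

  column-balanced : ∀ a j → countPos 2 (col (blocks a) j) ≡ countNeg 2 (col (blocks a) j)
  column-balanced a j = countPos≡countNeg 2 (col (blocks a) j)
    (group-column-signum (combine a (proj₁ (remQuot {U} 6 j))) (proj₂ (remQuot {U} 6 j)))

  σ : Fin (U * 3) → ℤ
  σ i = σ-for D (proj₂ (remQuot {U} 3 i))

  pair-column-sum : ∀ a i e j → toℕ j ≡ 2 * toℕ i + toℕ e →
                    let (u , r) = remQuot {U} 3 i in
                    sumℤ 2 (col (blocks a) j) ≡ sumℤ 2 (λ i′ → groupEntry (combine a u) i′ (pairColumn r e))
  pair-column-sum a i e j j≡ =
    cong (λ (u , v) → sumℤ 2 (λ i′ → groupEntry (combine a u) i′ v)) (remQuot-pair {U} {3} i e j j≡)

  conditionC : ConditionC blocks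
  conditionC = U * 3 , columns≡ U , σ , λ a →
    (row-balanced a , column-balanced a) , row-sum a ,
    (λ i j j≡ → trans (pair-column-sum a i zero j (trans j≡ (sym (+-identityʳ _))))
                      (proj₁ (group-pair-sums _ _))) ,
    (λ i j j≡ → trans (pair-column-sum a i (suc zero) j (trans j≡ (+-comm 1 _)))
                      (proj₂ (group-pair-sums _ _)))
    where
    columns≡ : ∀ U → U * 6 ≡ 2 * (U * 3)
    columns≡ = solve-∀

  abs-blocks : ∀ a i u v → let w = combine a u in
               ∣ blocks a i (combine u v) ∣ ≡ value (combine w (cellIndex (cell (tileOf w) i v)))
  abs-blocks a i u v =
    trans (cong ∣_∣ (blocks-combine a i u v)) (abs-◃ (cellSign c) (value (combine w (cellIndex c))))
    where
    w = combine a u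
    c = cell (tileOf w) i v

  value-occurs : ∀ a u k → InSupp blocks (value (combine (combine a u) k))
  value-occurs a u k =
    let (i , v , index≡k) = WellFormed.covers (wellFormed (tileOf (combine a u))) k in
    a , i , combine u v , trans (abs-blocks a i u v) (cong (value ∘ combine (combine a u)) index≡k)

  every-value-occurs : ∀ n → InSupp blocks (value n)
  every-value-occurs n =
    subst (InSupp blocks ∘ value) (combine-remQuot {K * U} 12 n)
      (subst (λ w′ → InSupp blocks (value (combine w′ k))) (combine-remQuot {K} U w)
        (value-occurs (proj₁ (remQuot {K} U w)) (proj₂ (remQuot {K} U w)) k))
    where
    w = proj₁ (remQuot {K * U} 12 n)
    k = proj₂ (remQuot {K * U} 12 n)

  occurrences-are-values : ∀ {x} → InSupp blocks x → Σ (Fin (K * U * 12)) λ n → value n ≡ x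
  occurrences-are-values (a , i , j , ∣e∣≡x) =
    combine w (cellIndex c) , trans (sym (abs-◃ (cellSign c) (value (combine w (cellIndex c))))) ∣e∣≡x
    where
    w = combine a (proj₁ (remQuot {U} 6 j))
    c = cell (tileOf w) i (proj₂ (remQuot {U} 6 j))

  support : ∀ {M h D′} → K * U * 12 ≡ M → M / D ≡ h → D ≡ D′ →
            ∀ x → InSupp blocks x ⇔ IntervalMinusMultiples M h D′ x
  support refl refl refl x = mk⇔
    (λ x∈ → let (n , value≡x) = occurrences-are-values x∈ in
            Equivalence.to (nonMultiple-image D (K * U * 12) x) (toℕ n , toℕ<n n , value≡x))
    (λ x∈ → let (n , n<M , value≡x) = Equivalence.from (nonMultiple-image D (K * U * 12) x) x∈ in
            subst (InSupp blocks) (trans (cong (nonMultiple D) (toℕ-fromℕ< n<M)) value≡x)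
                  (every-value-occurs (fromℕ< n<M)))

open import Data.Nat using (_+_; _*_; _/_; pred; z≤n; s≤s; >-nonZero)
open import Data.Nat.DivMod using (m/n*n≡m; *-/-assoc; m*n/m*o≡n/o; m≥n⇒m/n>0; /-congʳ)
open import Data.Nat.Divisibility using (∣⇒≤)
open import Data.Nat.Properties using (suc-pred; *-comm; *-assoc; *-mono-≤; ≤-trans; m*n≢0)
open import Data.Nat.Tactic.RingSolver using (solve-∀)

grid-size : ∀ {m s} → 2 ∣ m → 6 ∣ s → m / 2 * (s / 6) * 12 ≡ m * s
grid-size {m} {s} 2∣m 6∣s = trans (regroup (m / 2) (s / 6)) (cong₂ _*_ (m/n*n≡m 2∣m) (m/n*n≡m 6∣s))
  where
  regroup : ∀ k u → k * u * 12 ≡ k * 2 * (u * 6)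
  regroup = solve-∀

module _ {M t : ℕ} .{{_ : NonZero t}} .{{_ : NonZero (M / t)}} (t∣M : t ∣ M) where

  private instance
    doubled-nonZero : NonZero (M / t * 2)
    doubled-nonZero = m*n≢0 (M / t) 2

  doubled-quotient : suc (pred (M / t)) * 2 ≡ 2 * M / t
  doubled-quotient = begin
    suc (pred (M / t)) * 2 ≡⟨ cong (_* 2) (suc-pred (M / t)) ⟩
    M / t * 2              ≡⟨ *-comm (M / t) 2 ⟩
    2 * (M / t)            ≡⟨ *-/-assoc 2 t∣M ⟨
    2 * M / t              ∎
    where open ≡-Reasoning

  divided-by-doubled-quotient : M / (suc (pred (M / t)) * 2) ≡ t / 2
  divided-by-doubled-quotient = begin
    M / (suc (pred (M / t)) * 2)  ≡⟨ /-congʳ (cong (_* 2) (suc-pred (M / t))) ⟩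
    M / (M / t * 2)               ≡⟨ cong (_/ (M / t * 2)) (m/n*n≡m t∣M) ⟨
    M / t * t / (M / t * 2)       ≡⟨ m*n/m*o≡n/o (M / t) t 2 ⟩
    t / 2                         ∎
    where open ≡-Reasoning

proposition4p7 : (m s t : ℕ) → 2 ∣ m → 2 ≤ m → 2 ∣ s → 6 ≤ s → 6 ∣ s →
    t ∣ m * s → .{{_ : NonZero t}} →
    Σ (Fin (m / 2) → Block 2 s) λ ℬ →
      ConditionC ℬ ×
      (∀ (x : ℕ) → InSupp ℬ x ⇔
        ((1 ≤ x × x ≤ m * s + t / 2) ×
         ¬ (Σ ℕ λ j → (1 ≤ j × j ≤ t / 2) × x ≡ j * ((2 * m * s) / t + 1))))
proposition4p7 m s t 2∣m 2≤m _ 6≤s 6∣s t∣ms =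
  subst (λ s′ → Σ (Fin (m / 2) → Block 2 s′) λ ℬ →
                  ConditionC ℬ × ∀ x → InSupp ℬ x ⇔ IntervalMinusMultiples (m * s) (t / 2) ((2 * m * s) / t) x)
        (m/n*n≡m 6∣s)
        (blocks , conditionC ,
         support (grid-size 2∣m 6∣s) (divided-by-doubled-quotient t∣ms)
                 (trans (doubled-quotient t∣ms) (cong (_/ t) (sym (*-assoc 2 m s)))))
  where
  instance
    ms≢0 : NonZero (m * s)
    ms≢0 = >-nonZero (≤-trans (s≤s z≤n) (*-mono-≤ 2≤m 6≤s))
    ms/t≢0 : NonZero (m * s / t)
    ms/t≢0 = >-nonZero (m≥n⇒m/n>0 (∣⇒≤ t∣ms))
  open Construction (m / 2) (s / 6) (pred (m * s / t))
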